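{- For every $n\in\mathbb{N}$, every $i\ge1$ and every $w\in\mathfrak{h}^1$, \[ \frac{q^{(i-1)(n+1)}}{[n+1]^{i}}\,A_w(n+1)=a_{z_iw+z_i\circ_+w}(n). \]
   Context: Let $\hbar$ be an indeterminate and $\mathcal{C}=\mathbb{Q}[\hbar]$. Let $\mathfrak{h}^1$ be the non-commutative polynomial algebra over $\mathcal{C}$ freely generated by letters $z_1,z_2,\dots$; juxtaposition is concatenation, words are monomials $z_{k_1}\cdots z_{k_r}$ ($r\ge0$, empty word $1$); $\mathfrak{h}^1_{>0}$ is the $\mathcal{C}$-span of nonempty words. Let $z_i\circ_+z_j=z_{i+j}+\hbar z_{i+j-1}$, acting on $\mathfrak{h}^1$ by $z_i\circ_+1=0$, $z_i\circ_+(z_jw)=(z_i\circ_+z_j)w$, $\mathcal{C}$-bilinearly. Let $\mathcal{R}=\mathbb{Q}[[q]]$, with $\hbar$ acting as multiplication by $1-q$, and $[m]=(1-q^m)/(1-q)$. For a word $u=z_{k_1}\cdots z_{k_r}$, $r\ge1$, and $n\ge0$: $A_u(n)=\sum_{n\ge m_1>\dots>m_r>0}\frac{q^{(k_1-1)m_1+\dots+(k_r-1)m_r}}{[m_1]^{k_1}\cdots[m_r]^{k_r}}$, $A_1(n)=1$, extended $\mathcal{C}$-linearly to $\mathfrak{h}^1$; and $a_u(n)=\sum_{n+1=m_1>m_2>\dots>m_r>0}\frac{q^{(k_1-1)m_1+\dots+(k_r-1)m_r}}{[m_1]^{k_1}\cdots[m_r]^{k_r}}$, extended $\mathcal{C}$-linearly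 to $\mathfrak{h}^1_{>0}$. -}

module Defs where

open import Data.Nat as ℕ using (ℕ; zero; suc; _≤_; _∸_; _≤ᵇ_; s≤s; z≤n)
open import Data.Nat.Properties using (≤-trans; m≤m+n)
open import Data.Rational as ℚ using (ℚ; 0ℚ; 1ℚ)
open import Data.List using (List; []; _∷_; map; foldr; upTo; zipWith; _++_)
open import Data.Bool using (if_then_else_)
open import Data.Product using (_×_; _,_)
open import Relation.Binary.PropositionalEquality using (_≡_)
import Data.Nat.Properties

-- The ring R = ℚ[[q]] of formal power series, as coefficient sequences.
-- Equality of power series is coefficientwise equality (_≐_).

PS : Set
PS = ℕ → ℚ

_≐_ : PS → PS → Set
f ≐ g = ∀ k → f k ≡ g k
infix 4 _≐_

sumℚ : List ℚ → ℚ
sumℚ = foldr ℚ._+_ 0ℚ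

const : ℚ → PS
const c zero    = c
const c (suc _) = 0ℚ

_⊕_ : PS → PS → PS
(f ⊕ g) k = f k ℚ.+ g k
infixl 6 _⊕_

⊖_ : PS → PS
(⊖ f) k = ℚ.- f k

_⊛_ : PS → PS → PS
(f ⊛ g) k = sumℚ (map (λ j → f j ℚ.* g (k ∸ j)) (upTo (suc k)))
infixl 7 _⊛_

zeroPS onePS : PS
zeroPS = const 0ℚ
onePS  = const 1ℚ

_^ₚ_ : PS → ℕ → PS
f ^ₚ zero    = onePS
f ^ₚ suc k   = f ⊛ (f ^ₚ k)

qpow : ℕ → PS
qpow n k = if (n ℕ.≡ᵇ k) then 1ℚ else 0ℚ

-- multiplicative inverse of a power series with constant term 1:
-- c_0 = 1,  c_k = - Σ_{j=1}^{k} f_j c_{k-j}.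
-- invL f k = [c_k , c_{k-1} , … , c_0]
invL : PS → ℕ → List ℚ
invL f zero    = 1ℚ ∷ []
invL f (suc k) =
  let cs = invL f k in
  (ℚ.- sumℚ (zipWith ℚ._*_ (map (λ j → f (suc j)) (upTo (suc k))) cs)) ∷ cs

inv : PS → PS
inv f k with invL f k
... | c ∷ _ = c
... | []    = 0ℚ

-- the q-integer [m] = (1 - q^m)/(1 - q) = 1 + q + … + q^{m-1}
qint : ℕ → PS
qint m k = if (suc k ℕ.≤ᵇ m) then 1ℚ else 0ℚ

ℏ-act : PS
ℏ-act = onePS ⊕ (⊖ qpow 1)

-- The coefficient ring C = ℚ[ℏ]: polynomials as coefficient lists
-- (constant term first), and their action on R (ℏ ↦ 1 - q).

Poly : Set
Poly = List ℚ

evalPoly : Poly → PS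
evalPoly []       = zeroPS
evalPoly (c ∷ cs) = const c ⊕ (ℏ-act ⊛ evalPoly cs)

ℏ·_ : Poly → Poly
ℏ· p = 0ℚ ∷ p

-- The algebra 𝔥¹: letters z_k (k ≥ 1), words, and C-linear combinations
-- of words (formal finite sums  Σ c_j · word_j).

data Letter : Set where
  z : (k : ℕ) → 1 ≤ k → Letter

index : Letter → ℕ
index (z k _) = k

Word : Set
Word = List Letter

H1 : Set
H1 = List (Poly × Word)

-- elements of 𝔥¹_{>0} : finite C-linear combinations of nonempty words
-- (a nonempty word is a first letter followed by a word)
H1pos : Set
H1pos = List (Poly × Letter × Word)

concatL : Letter → H1 → H1pos
concatL l = map (λ { (c , u) → (c , l , u) })

-- z_i ∘₊ z_j = z_{i+j} + ℏ z_{i+j-1}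
letter+ : Letter → Letter → Letter
letter+ (z i p) (z j q) = z (i ℕ.+ j) (≤-trans p (m≤m+n i j))

letter+- : Letter → Letter → Letter
letter+- (z (suc i) p) (z j q) = z (i ℕ.+ j) (≤-trans q (Data.Nat.Properties.m≤n+m j i))
letter+- (z zero ()) _

circ+ : Letter → H1 → H1pos
circ+ l [] = []
circ+ l ((c , []) ∷ rest)    = circ+ l rest
circ+ l ((c , m ∷ u) ∷ rest) =
  (c , letter+ l m , u) ∷ (ℏ· c , letter+- l m , u) ∷ circ+ l rest

term : ℕ → ℕ → PS
term m k = qpow ((k ∸ 1) ℕ.* m) ⊛ inv (qint m ^ₚ k)

-- A_u(n) = Σ_{n ≥ m_1 > … > m_r > 0} Π_j q^{(k_j-1)m_j}/[m_j]^{k_j},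
-- computed by recursion on the word: A_1(n) = 1,
-- A_{z_k u}(n) = Σ_{m=1}^{n} term(m,k) · A_u(m-1)
Aword : Word → ℕ → PS
Aword []      n = onePS
Aword (l ∷ u) n k =
  sumℚ (map (λ m → (term (suc m) (index l) ⊛ Aword u m) k) (upTo n))

sumPS : List PS → PS
sumPS = foldr _⊕_ zeroPS

A : H1 → ℕ → PS
A w n = sumPS (map (λ { (c , u) → evalPoly c ⊛ Aword u n }) w)

-- a_{z_k u}(n) = Σ_{n+1 = m_1 > m_2 > … > m_r > 0} … = term(n+1,k) · A_u(n)
aword : Letter → Word → ℕ → PS
aword l u n = term (suc n) (index l) ⊛ Aword u n

a : H1pos → ℕ → PS
a w n = sumPS (map (λ { (c , l , u) → evalPoly c ⊛ aword l u n }) w)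

module Submission where

-- Both sides are C-linear in w, and A_{z_j v}(n+1) = A_{z_j v}(n) + t_j A_v(n)
-- where t_k = q^{(k-1)(n+1)} / [n+1]^k.  Since t_i A_{z_j v}(n) = a_{z_i z_j v}(n),
-- the theorem reduces to the one-variable identity
--     t_i t_j = t_{i+j} + ℏ t_{i+j-1}            (i, j ≥ 1),
-- which after multiplying by [n+1]^{i+j} says  q^{n+1} + (1-q)[n+1] = 1.

open import Defs
open import Data.Nat using (ℕ; suc; _≤_; _∸_; _*_)
open import Data.List using (_++_)

open import Data.Nat as N using (zero)
import Data.Nat.Properties as NP
open import Data.Rational as Q using (ℚ; 0ℚ; 1ℚ)
import Data.Rational.Properties as QP
open import Data.Rational.Solver using (module +-*-Solver)
open import Data.List as L using ([]; _∷_; map; upTo)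
import Data.List.Properties as LP
open import Data.Product using (_,_)
open import Data.Maybe using (Maybe; just; nothing)
open import Relation.Nullary using (yes; no)
open import Relation.Binary.PropositionalEquality
open import Function using (id)
open import Level using (0ℓ)
open import Algebra.Bundles using (CommutativeRing)
import Algebra.Solver.Ring
import Algebra.Solver.Ring.AlmostCommutativeRing as ACR
import Relation.Binary.Reasoning.Setoid as SetoidReasoning

module PowerSeriesRing where
  open +-*-Solver using (solve; _:=_; _:+_; _:*_; con)

  -- The tail of a series.  Convolution obeys the recursion
  -- (f ⊛ g)_{k+1} = f₀ g_{k+1} + (tail f ⊛ g)_k, which drives every ring law below.
  tailPS : PS → PS
  tailPS f k = f (suc k)

  ⊛-suc : ∀ f g k → (f ⊛ g) (suc k) ≡ f 0 Q.* g (suc k) Q.+ (tailPS f ⊛ g) k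
  ⊛-suc f g k = cong (f 0 Q.* g (suc k) Q.+_) (cong sumℚ
    (trans (LP.map-applyUpTo suc summand (suc k)) (sym (LP.map-applyUpTo id tailSummand (suc k)))))
    where
    summand tailSummand : ℕ → ℚ
    summand j = f j Q.* g (suc k ∸ j)
    tailSummand j = f (suc j) Q.* g (k ∸ j)

  ≐-refl : ∀ {f} → f ≐ f
  ≐-refl k = refl

  ≐-sym : ∀ {f g} → f ≐ g → g ≐ f
  ≐-sym p k = sym (p k)

  ≐-trans : ∀ {f g h} → f ≐ g → g ≐ h → f ≐ h
  ≐-trans p q k = trans (p k) (q k)

  zeroPS-coeff : ∀ k → zeroPS k ≡ 0ℚ
  zeroPS-coeff zero    = refl
  zeroPS-coeff (suc k) = refl

  ⊛-cong : ∀ {f f' g g'} → f ≐ f' → g ≐ g' → f ⊛ g ≐ f' ⊛ g'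
  ⊛-cong p q zero = cong₂ (λ x y → x Q.* y Q.+ 0ℚ) (p 0) (q 0)
  ⊛-cong {f} {f'} {g} {g'} p q (suc k) = begin
    (f ⊛ g) (suc k)                            ≡⟨ ⊛-suc f g k ⟩
    f 0 Q.* g (suc k) Q.+ (tailPS f ⊛ g) k     ≡⟨ cong₂ Q._+_ (cong₂ Q._*_ (p 0) (q (suc k)))
                                                        (⊛-cong {tailPS f} {tailPS f'} (λ j → p (suc j)) q k) ⟩
    f' 0 Q.* g' (suc k) Q.+ (tailPS f' ⊛ g') k ≡⟨ ⊛-suc f' g' k ⟨
    (f' ⊛ g') (suc k)                          ∎
    where open ≡-Reasoning

  -- The identically zero sequence annihilates: needed because the tail of a
  -- constant series is zero.
  vanishing-⊛ : ∀ g k → ((λ _ → 0ℚ) ⊛ g) k ≡ 0ℚ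
  vanishing-⊛ g zero    = solve 1 (λ x → con 0ℚ :* x :+ con 0ℚ := con 0ℚ) refl (g 0)
  vanishing-⊛ g (suc k) = begin
    ((λ _ → 0ℚ) ⊛ g) (suc k)                  ≡⟨ ⊛-suc (λ _ → 0ℚ) g k ⟩
    0ℚ Q.* g (suc k) Q.+ ((λ _ → 0ℚ) ⊛ g) k ≡⟨ cong (0ℚ Q.* g (suc k) Q.+_) (vanishing-⊛ g k) ⟩
    0ℚ Q.* g (suc k) Q.+ 0ℚ                   ≡⟨ solve 1 (λ x → con 0ℚ :* x :+ con 0ℚ := con 0ℚ) refl (g (suc k)) ⟩
    0ℚ                                        ∎
    where open ≡-Reasoning

  const-⊛ : ∀ c g → const c ⊛ g ≐ (λ k → c Q.* g k)
  const-⊛ c g zero    = QP.+-identityʳ _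
  const-⊛ c g (suc k) = begin
    (const c ⊛ g) (suc k)                   ≡⟨ ⊛-suc (const c) g k ⟩
    c Q.* g (suc k) Q.+ ((λ _ → 0ℚ) ⊛ g) k ≡⟨ cong (c Q.* g (suc k) Q.+_) (vanishing-⊛ g k) ⟩
    c Q.* g (suc k) Q.+ 0ℚ                  ≡⟨ QP.+-identityʳ _ ⟩
    c Q.* g (suc k)                         ∎
    where open ≡-Reasoning

  -- The ring laws of ⊛ (right-hand versions follow from commutativity).
  ⊛-identityˡ : ∀ g → onePS ⊛ g ≐ g
  ⊛-identityˡ g k = trans (const-⊛ 1ℚ g k) (QP.*-identityˡ (g k))

  ⊛-distribʳ : ∀ f g h → (f ⊕ g) ⊛ h ≐ (f ⊛ h) ⊕ (g ⊛ h)
  ⊛-distribʳ f g h zero =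
    solve 3 (λ a b c → (a :+ b) :* c :+ con 0ℚ := (a :* c :+ con 0ℚ) :+ (b :* c :+ con 0ℚ)) refl (f 0) (g 0) (h 0)
  ⊛-distribʳ f g h (suc k) = begin
    ((f ⊕ g) ⊛ h) (suc k)
      ≡⟨ ⊛-suc (f ⊕ g) h k ⟩
    (f 0 Q.+ g 0) Q.* h (suc k) Q.+ ((tailPS f ⊕ tailPS g) ⊛ h) k
      ≡⟨ cong ((f 0 Q.+ g 0) Q.* h (suc k) Q.+_) (⊛-distribʳ (tailPS f) (tailPS g) h k) ⟩
    (f 0 Q.+ g 0) Q.* h (suc k) Q.+ ((tailPS f ⊛ h) k Q.+ (tailPS g ⊛ h) k)
      ≡⟨ solve 5 (λ a b c x y → (a :+ b) :* c :+ (x :+ y) := (a :* c :+ x) :+ (b :* c :+ y))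
               refl (f 0) (g 0) (h (suc k)) ((tailPS f ⊛ h) k) ((tailPS g ⊛ h) k) ⟩
    (f 0 Q.* h (suc k) Q.+ (tailPS f ⊛ h) k) Q.+ (g 0 Q.* h (suc k) Q.+ (tailPS g ⊛ h) k)
      ≡⟨ cong₂ Q._+_ (⊛-suc f h k) (⊛-suc g h k) ⟨
    ((f ⊛ h) ⊕ (g ⊛ h)) (suc k) ∎
    where open ≡-Reasoning

  tail-⊛ : ∀ f g → tailPS (f ⊛ g) ≐ const (f 0) ⊛ tailPS g ⊕ tailPS f ⊛ g
  tail-⊛ f g k = trans (⊛-suc f g k) (cong (Q._+ (tailPS f ⊛ g) k) (sym (const-⊛ (f 0) (tailPS g) k)))

  ⊛-assoc : ∀ f g h → (f ⊛ g) ⊛ h ≐ f ⊛ (g ⊛ h)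
  ⊛-assoc f g h zero =
    solve 3 (λ a b c → (a :* b :+ con 0ℚ) :* c :+ con 0ℚ := a :* (b :* c :+ con 0ℚ) :+ con 0ℚ) refl (f 0) (g 0) (h 0)
  ⊛-assoc f g h (suc k) = begin
    ((f ⊛ g) ⊛ h) (suc k)
      ≡⟨ ⊛-suc (f ⊛ g) h k ⟩
    (f ⊛ g) 0 Q.* h (suc k) Q.+ (tailPS (f ⊛ g) ⊛ h) k
      ≡⟨ cong ((f ⊛ g) 0 Q.* h (suc k) Q.+_) tailProduct ⟩
    (f 0 Q.* g 0 Q.+ 0ℚ) Q.* h (suc k) Q.+ (f 0 Q.* (tailPS g ⊛ h) k Q.+ (tailPS f ⊛ (g ⊛ h)) k)
      ≡⟨ solve 5 (λ a b c x y → (a :* b :+ con 0ℚ) :* c :+ (a :* x :+ y) := a :* (b :* c :+ x) :+ y)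
               refl (f 0) (g 0) (h (suc k)) ((tailPS g ⊛ h) k) ((tailPS f ⊛ (g ⊛ h)) k) ⟩
    f 0 Q.* (g 0 Q.* h (suc k) Q.+ (tailPS g ⊛ h) k) Q.+ (tailPS f ⊛ (g ⊛ h)) k
      ≡⟨ cong (λ x → f 0 Q.* x Q.+ (tailPS f ⊛ (g ⊛ h)) k) (⊛-suc g h k) ⟨
    f 0 Q.* (g ⊛ h) (suc k) Q.+ (tailPS f ⊛ (g ⊛ h)) k
      ≡⟨ ⊛-suc f (g ⊛ h) k ⟨
    (f ⊛ (g ⊛ h)) (suc k) ∎
    where
    open ≡-Reasoning
    tailProduct : (tailPS (f ⊛ g) ⊛ h) k ≡ f 0 Q.* (tailPS g ⊛ h) k Q.+ (tailPS f ⊛ (g ⊛ h)) k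
    tailProduct = begin
      (tailPS (f ⊛ g) ⊛ h) k
        ≡⟨ ⊛-cong {tailPS (f ⊛ g)} {const (f 0) ⊛ tailPS g ⊕ tailPS f ⊛ g} (tail-⊛ f g) (≐-refl {h}) k ⟩
      ((const (f 0) ⊛ tailPS g ⊕ tailPS f ⊛ g) ⊛ h) k
        ≡⟨ ⊛-distribʳ (const (f 0) ⊛ tailPS g) (tailPS f ⊛ g) h k ⟩
      ((const (f 0) ⊛ tailPS g) ⊛ h) k Q.+ ((tailPS f ⊛ g) ⊛ h) k
        ≡⟨ cong₂ Q._+_ (trans (⊛-assoc (const (f 0)) (tailPS g) h k) (const-⊛ (f 0) (tailPS g ⊛ h) k))
                       (⊛-assoc (tailPS f) g h k) ⟩
      f 0 Q.* (tailPS g ⊛ h) k Q.+ (tailPS f ⊛ (g ⊛ h)) k ∎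

  -- Commutativity, by recursion on the coefficient: both orders reduce to
  -- f₀g_{k+2} + g₀f_{k+2} + (tail f ⊛ tail g)_k.
  ⊛-comm : ∀ f g → f ⊛ g ≐ g ⊛ f
  ⊛-comm f g zero = cong (Q._+ 0ℚ) (QP.*-comm (f 0) (g 0))
  ⊛-comm f g (suc zero) =
    solve 4 (λ a b c d → a :* b :+ (c :* d :+ con 0ℚ) := d :* c :+ (b :* a :+ con 0ℚ)) refl (f 0) (g 1) (f 1) (g 0)
  ⊛-comm f g (suc (suc k)) = begin
    (f ⊛ g) (2 N.+ k)
      ≡⟨ ⊛-suc f g (suc k) ⟩
    f 0 Q.* g (2 N.+ k) Q.+ (tailPS f ⊛ g) (suc k)
      ≡⟨ cong (f 0 Q.* g (2 N.+ k) Q.+_) (trans (⊛-comm (tailPS f) g (suc k)) (⊛-suc g (tailPS f) k)) ⟩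
    f 0 Q.* g (2 N.+ k) Q.+ (g 0 Q.* f (2 N.+ k) Q.+ (tailPS g ⊛ tailPS f) k)
      ≡⟨ cong (λ x → f 0 Q.* g (2 N.+ k) Q.+ (g 0 Q.* f (2 N.+ k) Q.+ x)) (⊛-comm (tailPS g) (tailPS f) k) ⟩
    f 0 Q.* g (2 N.+ k) Q.+ (g 0 Q.* f (2 N.+ k) Q.+ (tailPS f ⊛ tailPS g) k)
      ≡⟨ solve 5 (λ a b c d x → a :* b :+ (c :* d :+ x) := c :* d :+ (a :* b :+ x))
               refl (f 0) (g (2 N.+ k)) (g 0) (f (2 N.+ k)) ((tailPS f ⊛ tailPS g) k) ⟩
    g 0 Q.* f (2 N.+ k) Q.+ (f 0 Q.* g (2 N.+ k) Q.+ (tailPS f ⊛ tailPS g) k)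
      ≡⟨ cong (g 0 Q.* f (2 N.+ k) Q.+_) (trans (⊛-comm (tailPS g) f (suc k)) (⊛-suc f (tailPS g) k)) ⟨
    g 0 Q.* f (2 N.+ k) Q.+ (tailPS g ⊛ f) (suc k)
      ≡⟨ ⊛-suc g f (suc k) ⟨
    (g ⊛ f) (2 N.+ k) ∎
    where open ≡-Reasoning

  PSring : CommutativeRing 0ℓ 0ℓ
  PSring = record
    { Carrier = PS ; _≈_ = _≐_ ; _+_ = _⊕_ ; _*_ = _⊛_ ; -_ = ⊖_ ; 0# = zeroPS ; 1# = onePS
    ; isCommutativeRing = record
      { isRing = record
        { +-isAbelianGroup = record
          { isGroup = record
            { isMonoid = record
              { isSemigroup = record
                { isMagma = record
                  { isEquivalence = record
                    { refl = λ {f} → ≐-refl {f} ; sym = λ {f} {g} → ≐-sym {f} {g}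
                    ; trans = λ {f} {g} {h} → ≐-trans {f} {g} {h} }
                  ; ∙-cong = λ p q k → cong₂ Q._+_ (p k) (q k) }
                ; assoc = λ f g h k → QP.+-assoc (f k) (g k) (h k) }
              ; identity = (λ f k → trans (cong (Q._+ f k) (zeroPS-coeff k)) (QP.+-identityˡ (f k)))
                         , (λ f k → trans (cong (f k Q.+_) (zeroPS-coeff k)) (QP.+-identityʳ (f k))) }
            ; inverse = (λ f k → trans (QP.+-inverseˡ (f k)) (sym (zeroPS-coeff k)))
                      , (λ f k → trans (QP.+-inverseʳ (f k)) (sym (zeroPS-coeff k)))
            ; ⁻¹-cong = λ p k → cong Q.-_ (p k) }
          ; comm = λ f g k → QP.+-comm (f k) (g k) }
        ; *-cong = λ {f} {f'} {g} {g'} → ⊛-cong {f} {f'} {g} {g'}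
        ; *-assoc = ⊛-assoc
        ; *-identity = ⊛-identityˡ , (λ f k → trans (⊛-comm f onePS k) (⊛-identityˡ f k))
        ; distrib = (λ f g h k → trans (⊛-comm f (g ⊕ h) k)
                       (trans (⊛-distribʳ g h f k) (cong₂ Q._+_ (⊛-comm g f k) (⊛-comm h f k))))
                  , (λ f g h → ⊛-distribʳ g h f) }
      ; *-comm = ⊛-comm } }

  -- Rational constants embed into ℚ[[q]] as a ring morphism (with decidable
  -- equality), which is what the ring solver needs to handle literals 0 and 1.
  constMorphism : CommutativeRing.rawRing QP.+-*-commutativeRing
                    ACR.-Raw-AlmostCommutative⟶ ACR.fromCommutativeRing PSring
  constMorphism = record
    { ⟦_⟧    = const
    ; +-homo = λ { a b zero → refl ; a b (suc k) → sym (QP.+-identityʳ 0ℚ) }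
    ; *-homo = λ { a b zero → sym (QP.+-identityʳ _)
                 ; a b (suc k) → sym (trans (const-⊛ a (const b) (suc k)) (QP.*-zeroʳ a)) }
    ; -‿homo = λ { a zero → refl ; a (suc k) → refl }
    ; 0-homo = λ k → refl
    ; 1-homo = λ k → refl }

  const-≟ : ∀ a b → Maybe (const a ≐ const b)
  const-≟ a b with a QP.≟ b
  ... | yes a≡b = just (λ k → cong (λ c → const c k) a≡b)
  ... | no _    = nothing

open PowerSeriesRing
open CommutativeRing PSring using () renaming (setoid to PSsetoid; +-cong to ⊕-cong)

module PS-Solver = Algebra.Solver.Ring (CommutativeRing.rawRing QP.+-*-commutativeRing)
                     (ACR.fromCommutativeRing PSring) constMorphism const-≟
open PS-Solver using (solve; _:=_; _:+_; _:*_; _:-_; con)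
module ≐-Reasoning = SetoidReasoning PSsetoid

qpow-zero : qpow 0 ≐ onePS
qpow-zero zero    = refl
qpow-zero (suc k) = refl

q⊛-zero : ∀ g → (qpow 1 ⊛ g) 0 ≡ 0ℚ
q⊛-zero g = trans (QP.+-identityʳ _) (QP.*-zeroˡ (g 0))

q⊛-suc : ∀ g k → (qpow 1 ⊛ g) (suc k) ≡ g k
q⊛-suc g k = begin
  (qpow 1 ⊛ g) (suc k)                      ≡⟨ ⊛-suc (qpow 1) g k ⟩
  0ℚ Q.* g (suc k) Q.+ (qpow 0 ⊛ g) k       ≡⟨ cong₂ Q._+_ (QP.*-zeroˡ (g (suc k)))
                                                       (trans (⊛-cong qpow-zero (≐-refl {g}) k) (⊛-identityˡ g k)) ⟩
  0ℚ Q.+ g k                                ≡⟨ QP.+-identityˡ (g k) ⟩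
  g k                                       ∎
  where open ≡-Reasoning

qpow-suc : ∀ a → qpow (suc a) ≐ qpow 1 ⊛ qpow a
qpow-suc a zero    = sym (q⊛-zero (qpow a))
qpow-suc a (suc k) = sym (q⊛-suc (qpow a) k)

qpow-+ : ∀ a b → qpow (a N.+ b) ≐ qpow a ⊛ qpow b
qpow-+ zero b = begin
  qpow b            ≈⟨ ⊛-identityˡ (qpow b) ⟨
  onePS ⊛ qpow b    ≈⟨ ⊛-cong qpow-zero (≐-refl {qpow b}) ⟨
  qpow 0 ⊛ qpow b   ∎
  where open ≐-Reasoning
qpow-+ (suc a) b = begin
  qpow (suc (a N.+ b))          ≈⟨ qpow-suc (a N.+ b) ⟩
  qpow 1 ⊛ qpow (a N.+ b)       ≈⟨ ⊛-cong {qpow 1} (≐-refl {qpow 1}) (qpow-+ a b) ⟩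
  qpow 1 ⊛ (qpow a ⊛ qpow b)    ≈⟨ ⊛-assoc (qpow 1) (qpow a) (qpow b) ⟨
  (qpow 1 ⊛ qpow a) ⊛ qpow b    ≈⟨ ⊛-cong (qpow-suc a) (≐-refl {qpow b}) ⟨
  qpow (suc a) ⊛ qpow b         ∎
  where open ≐-Reasoning

^ₚ-+ : ∀ f a b → f ^ₚ (a N.+ b) ≐ (f ^ₚ a) ⊛ (f ^ₚ b)
^ₚ-+ f zero b = ≐-sym {onePS ⊛ (f ^ₚ b)} (⊛-identityˡ (f ^ₚ b))
^ₚ-+ f (suc a) b = begin
  f ⊛ (f ^ₚ (a N.+ b))          ≈⟨ ⊛-cong {f} (≐-refl {f}) (^ₚ-+ f a b) ⟩
  f ⊛ ((f ^ₚ a) ⊛ (f ^ₚ b))     ≈⟨ ⊛-assoc f (f ^ₚ a) (f ^ₚ b) ⟨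
  (f ⊛ (f ^ₚ a)) ⊛ (f ^ₚ b)     ∎
  where open ≐-Reasoning

qint-suc : ∀ m → qint (suc m) ≐ onePS ⊕ qpow 1 ⊛ qint m
qint-suc m zero    = sym (trans (cong (1ℚ Q.+_) (q⊛-zero (qint m))) (QP.+-identityʳ 1ℚ))
qint-suc m (suc k) = sym (trans (cong (0ℚ Q.+_) (q⊛-suc (qint m) k)) (QP.+-identityˡ _))

ℏ-qint : ∀ m → ℏ-act ⊛ qint m ≐ onePS ⊕ ⊖ qpow m
ℏ-qint zero = begin
  ℏ-act ⊛ qint 0       ≈⟨ ⊛-cong {ℏ-act} {ℏ-act} {qint 0} {zeroPS} ≐-refl (λ { zero → refl ; (suc k) → refl }) ⟩
  ℏ-act ⊛ zeroPS       ≈⟨ solve 1 (λ h → h :* con 0ℚ := con 1ℚ :- con 1ℚ) (λ k → refl) ℏ-act ⟩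
  onePS ⊕ ⊖ onePS      ≈⟨ ⊕-cong {onePS} (≐-refl {onePS}) (λ k → cong Q.-_ (qpow-zero k)) ⟨
  onePS ⊕ ⊖ qpow 0     ∎
  where open ≐-Reasoning
ℏ-qint (suc m) = begin
  ℏ-act ⊛ qint (suc m)                ≈⟨ ⊛-cong {ℏ-act} (≐-refl {ℏ-act}) (qint-suc m) ⟩
  ℏ-act ⊛ (onePS ⊕ qpow 1 ⊛ qint m)
    ≈⟨ solve 2 (λ x p → (con 1ℚ :- x) :* (con 1ℚ :+ x :* p) := (con 1ℚ :- x) :+ x :* ((con 1ℚ :- x) :* p))
             (λ k → refl) (qpow 1) (qint m) ⟩
  ℏ-act ⊕ qpow 1 ⊛ (ℏ-act ⊛ qint m)   ≈⟨ ⊕-cong {ℏ-act} (≐-refl {ℏ-act}) (⊛-cong {qpow 1} (≐-refl {qpow 1}) (ℏ-qint m)) ⟩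
  ℏ-act ⊕ qpow 1 ⊛ (onePS ⊕ ⊖ qpow m)
    ≈⟨ solve 2 (λ x y → (con 1ℚ :- x) :+ x :* (con 1ℚ :- y) := con 1ℚ :- x :* y) (λ k → refl) (qpow 1) (qpow m) ⟩
  onePS ⊕ ⊖ (qpow 1 ⊛ qpow m)         ≈⟨ ⊕-cong {onePS} (≐-refl {onePS}) (λ k → cong Q.-_ (qpow-suc m k)) ⟨
  onePS ⊕ ⊖ qpow (suc m)              ∎
  where open ≐-Reasoning

invL-coefficients : ∀ f k → invL f k ≡ map (λ j → inv f (k ∸ j)) (upTo (suc k))
invL-coefficients f zero    = refl
invL-coefficients f (suc k) = cong (inv f (suc k) ∷_) (begin
  invL f k                                                ≡⟨ invL-coefficients f k ⟩
  map (λ j → inv f (k ∸ j)) (upTo (suc k))                ≡⟨ LP.map-applyUpTo id (λ j → inv f (k ∸ j)) (suc k) ⟩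
  L.applyUpTo (λ j → inv f (k ∸ j)) (suc k)               ≡⟨ LP.map-applyUpTo suc (λ j → inv f (suc k ∸ j)) (suc k) ⟨
  map (λ j → inv f (suc k ∸ j)) (L.applyUpTo suc (suc k)) ∎)
  where open ≡-Reasoning

inv-suc : ∀ f k → inv f (suc k) ≡ Q.- (tailPS f ⊛ inv f) k
inv-suc f k = cong (λ cs → Q.- sumℚ cs) (begin
  L.zipWith Q._*_ (map (λ j → f (suc j)) (upTo (suc k))) (invL f k)
    ≡⟨ cong (L.zipWith Q._*_ (map (λ j → f (suc j)) (upTo (suc k)))) (invL-coefficients f k) ⟩
  L.zipWith Q._*_ (map (λ j → f (suc j)) (upTo (suc k))) (map (λ j → inv f (k ∸ j)) (upTo (suc k)))
    ≡⟨ zipWith-diagonal (upTo (suc k)) ⟩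
  map (λ j → f (suc j) Q.* inv f (k ∸ j)) (upTo (suc k)) ∎)
  where
  open ≡-Reasoning
  zipWith-diagonal : ∀ js → L.zipWith Q._*_ (map (λ j → f (suc j)) js) (map (λ j → inv f (k ∸ j)) js)
                              ≡ map (λ j → f (suc j) Q.* inv f (k ∸ j)) js
  zipWith-diagonal []       = refl
  zipWith-diagonal (j ∷ js) = cong (f (suc j) Q.* inv f (k ∸ j) ∷_) (zipWith-diagonal js)

inv-inverseʳ : ∀ f → f 0 ≡ 1ℚ → f ⊛ inv f ≐ onePS
inv-inverseʳ f f₀≡1 zero    = cong (λ x → x Q.* 1ℚ Q.+ 0ℚ) f₀≡1
inv-inverseʳ f f₀≡1 (suc k) = begin
  (f ⊛ inv f) (suc k)                                   ≡⟨ ⊛-suc f (inv f) k ⟩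
  f 0 Q.* inv f (suc k) Q.+ (tailPS f ⊛ inv f) k        ≡⟨ cong₂ (λ x y → x Q.* y Q.+ (tailPS f ⊛ inv f) k) f₀≡1 (inv-suc f k) ⟩
  1ℚ Q.* (Q.- (tailPS f ⊛ inv f) k) Q.+ (tailPS f ⊛ inv f) k
    ≡⟨ cong (Q._+ (tailPS f ⊛ inv f) k) (QP.*-identityˡ (Q.- (tailPS f ⊛ inv f) k)) ⟩
  Q.- (tailPS f ⊛ inv f) k Q.+ (tailPS f ⊛ inv f) k     ≡⟨ QP.+-inverseˡ ((tailPS f ⊛ inv f) k) ⟩
  0ℚ                                                    ∎
  where open ≡-Reasoning

inv-cancel : ∀ f → f 0 ≡ 1ℚ → ∀ g → (g ⊛ inv f) ⊛ f ≐ g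
inv-cancel f f₀≡1 g = begin
  (g ⊛ inv f) ⊛ f     ≈⟨ solve 3 (λ g i f → (g :* i) :* f := g :* (f :* i)) (λ k → refl) g (inv f) f ⟩
  g ⊛ (f ⊛ inv f)     ≈⟨ ⊛-cong {g} (≐-refl {g}) (inv-inverseʳ f f₀≡1) ⟩
  g ⊛ onePS           ≈⟨ solve 1 (λ g → g :* con 1ℚ := g) (λ k → refl) g ⟩
  g                   ∎
  where open ≐-Reasoning

⊛-cancelʳ : ∀ f → f 0 ≡ 1ℚ → ∀ g h → g ⊛ f ≐ h ⊛ f → g ≐ h
⊛-cancelʳ f f₀≡1 g h gf≐hf = begin
  g                   ≈⟨ inv-cancel f f₀≡1 g ⟨
  (g ⊛ inv f) ⊛ f     ≈⟨ solve 3 (λ g i f → (g :* i) :* f := (g :* f) :* i) (λ k → refl) g (inv f) f ⟩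
  (g ⊛ f) ⊛ inv f     ≈⟨ ⊛-cong gf≐hf (≐-refl {inv f}) ⟩
  (h ⊛ f) ⊛ inv f     ≈⟨ solve 3 (λ h i f → (h :* i) :* f := (h :* f) :* i) (λ k → refl) h (inv f) f ⟨
  (h ⊛ inv f) ⊛ f     ≈⟨ inv-cancel f f₀≡1 h ⟩
  h                   ∎
  where open ≐-Reasoning

^ₚ-constant : ∀ f n → f 0 ≡ 1ℚ → (f ^ₚ n) 0 ≡ 1ℚ
^ₚ-constant f zero    f₀≡1 = refl
^ₚ-constant f (suc n) f₀≡1 = cong₂ (λ x y → x Q.* y Q.+ 0ℚ) f₀≡1 (^ₚ-constant f n f₀≡1)

-- For the rest of the file M = m+1 and t_k = term M k = q^{(k-1)M} / [M]^k.
-- Multiplying t_{k+1} by its denominator [M]^{k+1} leaves q^{kM}.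
term-cleared : ∀ m k → term (suc m) (suc k) ⊛ (qint (suc m) ^ₚ suc k) ≐ qpow (k * suc m)
term-cleared m k = inv-cancel (qint (suc m) ^ₚ suc k) (^ₚ-constant (qint (suc m)) (suc k) refl) (qpow (k * suc m))

-- The one-letter q-stuffle identity  t_{i+1} t_{j+1} = t_{i+j+2} + ℏ t_{i+j+1}:
-- after clearing the denominator [M]^{i+j+2} both sides equal q^{(i+j)M},
-- the right-hand side because q^M + ℏ[M] = 1.
term-product : ∀ m i j → term (suc m) (suc i) ⊛ term (suc m) (suc j)
                           ≐ term (suc m) (suc i N.+ suc j) ⊕ ℏ-act ⊛ term (suc m) (i N.+ suc j)
term-product m i j rewrite NP.+-suc i j =
  ⊛-cancelʳ (P ^ₚ suc (suc e)) (^ₚ-constant P (suc (suc e)) refl) _ _ (≐-trans {g = qpow (e * M)} lhs (≐-sym rhs))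
  where
  M e : ℕ
  M = suc m
  e = i N.+ j
  P : PS
  P = qint M
  t : ℕ → PS
  t = term M
  lhs : (t (suc i) ⊛ t (suc j)) ⊛ (P ^ₚ suc (suc e)) ≐ qpow (e * M)
  lhs = begin
    (t (suc i) ⊛ t (suc j)) ⊛ (P ^ₚ suc (suc e))
      ≈⟨ ⊛-cong {t (suc i) ⊛ t (suc j)} ≐-refl
           (λ k → cong (λ n → (P ^ₚ suc n) k) (NP.+-suc i j)) ⟨
    (t (suc i) ⊛ t (suc j)) ⊛ (P ^ₚ (suc i N.+ suc j))
      ≈⟨ ⊛-cong {t (suc i) ⊛ t (suc j)} ≐-refl (^ₚ-+ P (suc i) (suc j)) ⟩
    (t (suc i) ⊛ t (suc j)) ⊛ ((P ^ₚ suc i) ⊛ (P ^ₚ suc j))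
      ≈⟨ solve 4 (λ a b c d → (a :* b) :* (c :* d) := (a :* c) :* (b :* d)) (λ k → refl)
               (t (suc i)) (t (suc j)) (P ^ₚ suc i) (P ^ₚ suc j) ⟩
    (t (suc i) ⊛ (P ^ₚ suc i)) ⊛ (t (suc j) ⊛ (P ^ₚ suc j))
      ≈⟨ ⊛-cong (term-cleared m i) (term-cleared m j) ⟩
    qpow (i * M) ⊛ qpow (j * M)
      ≈⟨ qpow-+ (i * M) (j * M) ⟨
    qpow (i * M N.+ j * M)
      ≈⟨ (λ k → cong (λ n → qpow n k) (NP.*-distribʳ-+ M i j)) ⟨
    qpow (e * M) ∎
    where open ≐-Reasoning
  rhs : (t (suc (suc e)) ⊕ ℏ-act ⊛ t (suc e)) ⊛ (P ^ₚ suc (suc e)) ≐ qpow (e * M)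
  rhs = begin
    (t (suc (suc e)) ⊕ ℏ-act ⊛ t (suc e)) ⊛ (P ⊛ (P ^ₚ suc e))
      ≈⟨ solve 5 (λ a h b p pe → (a :+ h :* b) :* (p :* pe) := a :* (p :* pe) :+ (h :* p) :* (b :* pe))
               (λ k → refl) (t (suc (suc e))) ℏ-act (t (suc e)) P (P ^ₚ suc e) ⟩
    t (suc (suc e)) ⊛ (P ^ₚ suc (suc e)) ⊕ (ℏ-act ⊛ P) ⊛ (t (suc e) ⊛ (P ^ₚ suc e))
      ≈⟨ ⊕-cong (term-cleared m (suc e)) (⊛-cong (ℏ-qint M) (term-cleared m e)) ⟩
    qpow (M N.+ e * M) ⊕ (onePS ⊕ ⊖ qpow M) ⊛ qpow (e * M)
      ≈⟨ ⊕-cong (qpow-+ M (e * M)) (≐-refl {(onePS ⊕ ⊖ qpow M) ⊛ qpow (e * M)}) ⟩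
    qpow M ⊛ qpow (e * M) ⊕ (onePS ⊕ ⊖ qpow M) ⊛ qpow (e * M)
      ≈⟨ solve 2 (λ x y → x :* y :+ (con 1ℚ :- x) :* y := y) (λ k → refl) (qpow M) (qpow (e * M)) ⟩
    qpow (e * M) ∎
    where open ≐-Reasoning

sumℚ-∷ʳ : ∀ xs x → sumℚ (xs L.∷ʳ x) ≡ sumℚ xs Q.+ x
sumℚ-∷ʳ []       x = trans (QP.+-identityʳ x) (sym (QP.+-identityˡ x))
sumℚ-∷ʳ (y ∷ ys) x = trans (cong (y Q.+_) (sumℚ-∷ʳ ys x)) (sym (QP.+-assoc y (sumℚ ys) x))

-- Raising the bound n of A_{z_k u} adds the terms with m₁ = n+1, which
-- together are exactly a_{z_k u}(n).
Aword-suc : ∀ l u n → Aword (l ∷ u) (suc n) ≐ Aword (l ∷ u) n ⊕ aword l u n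
Aword-suc l u n k = begin
  sumℚ (map summand (upTo (suc n)))          ≡⟨ cong sumℚ (LP.map-upTo summand (suc n)) ⟩
  sumℚ (L.applyUpTo summand (suc n))         ≡⟨ cong sumℚ (LP.applyUpTo-∷ʳ summand n) ⟨
  sumℚ (L.applyUpTo summand n L.∷ʳ summand n) ≡⟨ sumℚ-∷ʳ (L.applyUpTo summand n) (summand n) ⟩
  sumℚ (L.applyUpTo summand n) Q.+ summand n  ≡⟨ cong (λ xs → sumℚ xs Q.+ summand n) (LP.map-upTo summand n) ⟨
  sumℚ (map summand (upTo n)) Q.+ summand n   ∎
  where
  open ≡-Reasoning
  summand : ℕ → ℚ
  summand m = (term (suc m) (index l) ⊛ Aword u m) k

a-++ : ∀ xs ys n → a (xs ++ ys) n ≐ a xs n ⊕ a ys n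
a-++ []                   ys n k = sym (trans (cong (Q._+ a ys n k) (zeroPS-coeff k)) (QP.+-identityˡ _))
a-++ ((c , l , u) ∷ xs) ys n k =
  trans (cong (first Q.+_) (a-++ xs ys n k)) (sym (QP.+-assoc first (a xs n k) (a ys n k)))
  where
  first : ℚ
  first = (evalPoly c ⊛ aword l u n) k

-- The theorem for a single word z_j v and a letter z_i:
--   t_i A_{z_j v}(n+1) = a_{z_i z_j v}(n) + a_{(z_i ∘₊ z_j) v}(n),
-- by splitting off m₁ = n+1 (Aword-suc) and applying term-product to t_i t_j.
term-Aword : ∀ n l l' v →
  term (suc n) (index l) ⊛ Aword (l' ∷ v) (suc n)
    ≐ aword l (l' ∷ v) n ⊕ (aword (letter+ l l') v n ⊕ ℏ-act ⊛ aword (letter+- l l') v n)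
term-Aword n (z zero ()) l' v
term-Aword n l (z zero ()) v
term-Aword n (z (suc i) _) (z (suc j) 1≤j+1) v = begin
  tᵢ ⊛ Aword u (suc n)                         ≈⟨ ⊛-cong {tᵢ} ≐-refl (Aword-suc (z (suc j) 1≤j+1) v n) ⟩
  tᵢ ⊛ (Aword u n ⊕ tⱼ ⊛ Aword v n)
    ≈⟨ solve 4 (λ t au t' av → t :* (au :+ t' :* av) := t :* au :+ (t :* t') :* av) (λ k → refl)
             tᵢ (Aword u n) tⱼ (Aword v n) ⟩
  tᵢ ⊛ Aword u n ⊕ (tᵢ ⊛ tⱼ) ⊛ Aword v n
    ≈⟨ ⊕-cong {tᵢ ⊛ Aword u n} ≐-refl (⊛-cong (term-product n i j) (≐-refl {Aword v n})) ⟩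
  tᵢ ⊛ Aword u n ⊕ (tᵢ₊ⱼ ⊕ ℏ-act ⊛ tᵢ₊ⱼ₋₁) ⊛ Aword v n
    ≈⟨ solve 5 (λ x s h s' av → x :+ (s :+ h :* s') :* av := x :+ (s :* av :+ h :* (s' :* av))) (λ k → refl)
             (tᵢ ⊛ Aword u n) tᵢ₊ⱼ ℏ-act tᵢ₊ⱼ₋₁ (Aword v n) ⟩
  tᵢ ⊛ Aword u n ⊕ (tᵢ₊ⱼ ⊛ Aword v n ⊕ ℏ-act ⊛ (tᵢ₊ⱼ₋₁ ⊛ Aword v n)) ∎
  where
  open ≐-Reasoning
  u : Word
  u = z (suc j) 1≤j+1 ∷ v
  tᵢ tⱼ tᵢ₊ⱼ tᵢ₊ⱼ₋₁ : PS
  tᵢ = term (suc n) (suc i)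
  tⱼ = term (suc n) (suc j)
  tᵢ₊ⱼ = term (suc n) (suc i N.+ suc j)
  tᵢ₊ⱼ₋₁ = term (suc n) (i N.+ suc j)

term-A : ∀ n l w → term (suc n) (index l) ⊛ A w (suc n) ≐ a (concatL l w) n ⊕ a (circ+ l w) n
term-A n l [] = solve 1 (λ t → t :* con 0ℚ := con 0ℚ :+ con 0ℚ) (λ k → refl) (term (suc n) (index l))
term-A n l ((c , []) ∷ rest) = begin
  t ⊛ (evalPoly c ⊛ onePS ⊕ A rest (suc n))
    ≈⟨ solve 3 (λ t e r → t :* (e :* con 1ℚ :+ r) := e :* (t :* con 1ℚ) :+ t :* r) (λ k → refl)
             t (evalPoly c) (A rest (suc n)) ⟩
  evalPoly c ⊛ (t ⊛ onePS) ⊕ t ⊛ A rest (suc n)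
    ≈⟨ ⊕-cong {evalPoly c ⊛ (t ⊛ onePS)} ≐-refl (term-A n l rest) ⟩
  evalPoly c ⊛ (t ⊛ onePS) ⊕ (a (concatL l rest) n ⊕ a (circ+ l rest) n)
    ≈⟨ solve 3 (λ x y w → x :+ (y :+ w) := (x :+ y) :+ w) (λ k → refl)
             (evalPoly c ⊛ (t ⊛ onePS)) (a (concatL l rest) n) (a (circ+ l rest) n) ⟩
  (evalPoly c ⊛ (t ⊛ onePS) ⊕ a (concatL l rest) n) ⊕ a (circ+ l rest) n ∎
  where
  open ≐-Reasoning
  t : PS
  t = term (suc n) (index l)
term-A n l ((c , l' ∷ v) ∷ rest) = begin
  t ⊛ (e ⊛ Aword (l' ∷ v) (suc n) ⊕ A rest (suc n))
    ≈⟨ solve 4 (λ t e au r → t :* (e :* au :+ r) := e :* (t :* au) :+ t :* r) (λ k → refl)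
             t e (Aword (l' ∷ v) (suc n)) (A rest (suc n)) ⟩
  e ⊛ (t ⊛ Aword (l' ∷ v) (suc n)) ⊕ t ⊛ A rest (suc n)
    ≈⟨ ⊕-cong (⊛-cong {e} ≐-refl (term-Aword n l l' v)) (term-A n l rest) ⟩
  e ⊛ (concat ⊕ (stuffle ⊕ ℏ-act ⊛ stuffle₋)) ⊕ (aConcat ⊕ aCirc)
    ≈⟨ solve 7 (λ e x y h y' ac ar → e :* (x :+ (y :+ h :* y')) :+ (ac :+ ar)
                  := (e :* x :+ ac) :+ (e :* y :+ ((con 0ℚ :+ h :* e) :* y' :+ ar))) (λ k → refl)
             e concat stuffle ℏ-act stuffle₋ aConcat aCirc ⟩
  (e ⊛ concat ⊕ aConcat) ⊕ (e ⊛ stuffle ⊕ ((const 0ℚ ⊕ ℏ-act ⊛ e) ⊛ stuffle₋ ⊕ aCirc)) ∎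
  where
  open ≐-Reasoning
  t e concat stuffle stuffle₋ aConcat aCirc : PS
  t = term (suc n) (index l)
  e = evalPoly c
  concat = aword l (l' ∷ v) n
  stuffle = aword (letter+ l l') v n
  stuffle₋ = aword (letter+- l l') v n
  aConcat = a (concatL l rest) n
  aCirc = a (circ+ l rest) n

lemma2p8 : (n i : ℕ) (hi : 1 ≤ i) (w : H1) →
    (qpow ((i ∸ 1) * suc n) ⊛ inv (qint (suc n) ^ₚ i)) ⊛ A w (suc n)
      ≐ a (concatL (z i hi) w ++ circ+ (z i hi) w) n
lemma2p8 n i hi w =
  ≐-trans (term-A n (z i hi) w) (≐-sym (a-++ (concatL (z i hi) w) (circ+ (z i hi) w) n))
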